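{- Let $v>3$ and let $(X,\mathcal{B})$ be a Steiner triple system of order $v$ with point set $X=\{1,\dots,v\}$. Then there is a sequencing $\pi=[x_1\,x_2\,\cdots\,x_v]$ of $X$ that is $3$-good for $(X,\mathcal{B})$, i.e. $\{x_i,x_{i+1},x_{i+2}\}\notin\mathcal{B}$ for all $1\le i\le v-2$.
   Context: A Steiner triple system of order $v$ is a pair $(X,\mathcal{B})$ where $X$ is a set of $v$ points and $\mathcal{B}$ is a set of 3-subsets of $X$ (blocks) such that every pair of distinct points lies in exactly one block. A sequencing of $X$ is an ordering of all points of $X$, each appearing exactly once. A sequencing is $3$-good if no three consecutive points in it form a block. -}

module Defs where

open import Data.Nat using (ℕ; suc; _+_; _<_)
open import Data.Fin using (Fin; toℕ)
open import Data.Fin.Subset using (Subset; ∣_∣; ⁅_⁆; _∪_; _∈_)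
open import Data.List using (List)
import Data.List.Membership.Propositional as LM
open import Data.List.Relation.Unary.Unique.Propositional using (Unique)
open import Data.Product using (Σ; ∃; _×_)
open import Relation.Binary.PropositionalEquality using (_≡_)
open import Relation.Nullary using (¬_)
open import Function.Bundles using (_↔_)

-- A Steiner triple system of order v on the point set X = Fin v
-- (standing for {1,…,v}).
record IsSTS (v : ℕ) (𝓑 : List (Subset v)) : Set where
  field
    distinct  : Unique 𝓑
    triples   : ∀ {B} → B LM.∈ 𝓑 → ∣ B ∣ ≡ 3
    covered   : ∀ (x y : Fin v) → ¬ x ≡ y →
                  Σ (Subset v) λ B → B LM.∈ 𝓑 × x ∈ B × y ∈ B
    unique    : ∀ (x y : Fin v) → ¬ x ≡ y → ∀ {B C} →
                  B LM.∈ 𝓑 → x ∈ B → y ∈ B →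
                  C LM.∈ 𝓑 → x ∈ C → y ∈ C → B ≡ C

-- A sequencing of X: an ordering [x₁ … x_v] of all points, each exactly
-- once, i.e. a bijection from positions Fin v to points Fin v.
Sequencing : ℕ → Set
Sequencing v = Fin v ↔ Fin v

triple : ∀ {v} → Fin v → Fin v → Fin v → Subset v
triple a b c = ⁅ a ⁆ ∪ ⁅ b ⁆ ∪ ⁅ c ⁆

-- 3-good: no three consecutive points form a block.  For all positions
-- i, j, k with j = i+1 and k = i+2 (so i ranges over 0 … v-3, 0-based),
-- {x_i, x_j, x_k} ∉ 𝓑.
Is3Good : ∀ {v} → List (Subset v) → (Fin v → Fin v) → Set
Is3Good {v} 𝓑 π =
  ∀ (i j k : Fin v) → toℕ j ≡ suc (toℕ i) → toℕ k ≡ suc (toℕ j) →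
    ¬ (triple (π i) (π j) (π k) LM.∈ 𝓑)

-- Fix a point ∞.  The blocks through ∞ pair off the remaining points: the
-- partner a′ of a is the third point of the block through ∞ and a.  A triple
-- containing a full pair {a, a′} but not ∞ is never a block, since the only
-- block through a and a′ is {∞, a, a′}.  Choosing a point o, list
--   o, a₁, a₁′, …, aₖ, aₖ′, o′, ∞
-- where {a₁, a₁′}, …, {aₖ, aₖ′} are the other pairs (k ≥ 1 as v > 3).  Every
-- window of three contains a full pair and avoids ∞, except the last one
-- {aₖ′, o′, ∞}, which is not a block because the block through o′ and ∞ is
-- {∞, o, o′} and aₖ′ ≠ o.
module Submission where

open import Defs
open import Data.Bool using (true; false)
open import Data.Empty using (⊥; ⊥-elim)
open import Data.Fin using (Fin; zero; suc; toℕ; cast)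
open import Data.Fin.Permutation using (Permutation; permutation; ↔⇒≡; cast-id; _∘ₚ_)
open import Data.Fin.Properties using (any?; _≟_; toℕ-injective; toℕ-cast)
open import Data.Fin.Subset using (Subset; ∣_∣; ⁅_⁆; _∪_; _-_; _∈_; _⊆_)
open import Data.Fin.Subset.Properties
  using (x∈p∪q⁺; x∈p∪q⁻; x∈⁅x⁆; x∈⁅y⁆⇒x≡y; ∣⁅x⁆∣≡1; p⊆q⇒∣p∣≤∣q∣; ⊆-antisym;
         x∈p∧x≢y⇒x∈p-y; x∈p⇒∣p-x∣<∣p∣; ∪-assoc; ∪-comm; _∈?_)
open import Data.List using (List; []; _∷_; _++_; length; lookup; filter; allFin)
open import Data.List.Membership.Propositional using () renaming (_∈_ to _∈ₗ_; _∉_ to _∉ₗ_)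
open import Data.List.Membership.Propositional.Properties
  using (∈-lookup; ∈-filter⁺; ∈-allFin; ∈-++⁺ˡ; ∈-++⁺ʳ; ∈-++⁻)
open import Data.List.Relation.Unary.All as All using (All; []; _∷_)
open import Data.List.Relation.Unary.All.Properties using (all-filter)
open import Data.List.Relation.Unary.AllPairs using ([]; _∷_)
open import Data.List.Relation.Unary.Any using (here; there; index)
open import Data.List.Relation.Unary.Any.Properties using (lookup-index)
open import Data.List.Relation.Unary.Unique.Propositional using (Unique)
import Data.List.Relation.Unary.Unique.Propositional.Properties as Unique
open import Data.Nat using (ℕ; suc; _+_; _≤_; _<_; z≤n; s≤s)
open import Data.Nat.Properties
  using (≤-trans; +-suc; +-monoʳ-≤; n≤1+n; suc-injective; <-asym; <-cmp; module ≤-Reasoning)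
  renaming (_<?_ to _<ℕ?_)
open import Data.Product using (Σ; ∃; _×_; _,_; proj₁; proj₂)
open import Data.Sum using (_⊎_; inj₁; inj₂; [_,_])
open import Data.Unit using (⊤)
open import Data.Vec using ([]; _∷_)
open import Function using (_∘_; id)
open import Function.Bundles using (Inverse)
open import Relation.Binary.Definitions using (tri<; tri≈; tri>)
open import Relation.Binary.PropositionalEquality
  using (_≡_; _≢_; refl; sym; trans; cong; cong₂; subst; ≢-sym; module ≡-Reasoning)
open import Relation.Nullary using (¬_; yes; no)
open import Relation.Nullary.Decidable using (_×-dec_; ¬?)
open import Relation.Unary using (Decidable)

∣p∪q∣≤∣p∣+∣q∣ : ∀ {n} (p q : Subset n) → ∣ p ∪ q ∣ ≤ ∣ p ∣ + ∣ q ∣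
∣p∪q∣≤∣p∣+∣q∣ [] [] = z≤n
∣p∪q∣≤∣p∣+∣q∣ (false ∷ p) (false ∷ q) = ∣p∪q∣≤∣p∣+∣q∣ p q
∣p∪q∣≤∣p∣+∣q∣ (false ∷ p) (true ∷ q) =
  subst (suc ∣ p ∪ q ∣ ≤_) (sym (+-suc ∣ p ∣ ∣ q ∣)) (s≤s (∣p∪q∣≤∣p∣+∣q∣ p q))
∣p∪q∣≤∣p∣+∣q∣ (true ∷ p) (false ∷ q) = s≤s (∣p∪q∣≤∣p∣+∣q∣ p q)
∣p∪q∣≤∣p∣+∣q∣ (true ∷ p) (true ∷ q) =
  s≤s (≤-trans (∣p∪q∣≤∣p∣+∣q∣ p q) (+-monoʳ-≤ ∣ p ∣ (n≤1+n ∣ q ∣)))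

unique⇒length≤∣p∣ : ∀ {n} {p : Subset n} {xs : List (Fin n)} →
  Unique xs → All (_∈ p) xs → length xs ≤ ∣ p ∣
unique⇒length≤∣p∣ [] [] = z≤n
unique⇒length≤∣p∣ {p = p} (x≢xs ∷ u) (x∈p ∷ xs⊆p) =
  ≤-trans (s≤s (unique⇒length≤∣p∣ u (All.zipWith in-p-x (xs⊆p , x≢xs)))) (x∈p⇒∣p-x∣<∣p∣ x∈p)
  where
  in-p-x : ∀ {x y} → y ∈ p × x ≢ y → y ∈ p - x
  in-p-x (y∈p , x≢y) = x∈p∧x≢y⇒x∈p-y y∈p (≢-sym x≢y)

module _ {n : ℕ} {x y z : Fin n} where

  x∈triple : x ∈ triple x y z
  x∈triple = x∈p∪q⁺ (inj₁ (x∈⁅x⁆ x))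

  y∈triple : y ∈ triple x y z
  y∈triple = x∈p∪q⁺ (inj₂ (x∈p∪q⁺ (inj₁ (x∈⁅x⁆ y))))

  z∈triple : z ∈ triple x y z
  z∈triple = x∈p∪q⁺ (inj₂ (x∈p∪q⁺ {p = ⁅ y ⁆} (inj₂ (x∈⁅x⁆ z))))

  ∈-triple⁻ : ∀ {w} → w ∈ triple x y z → w ≡ x ⊎ w ≡ y ⊎ w ≡ z
  ∈-triple⁻ {w} w∈ with x∈p∪q⁻ ⁅ x ⁆ (⁅ y ⁆ ∪ ⁅ z ⁆) w∈
  ... | inj₁ w∈x = inj₁ (x∈⁅y⁆⇒x≡y x w∈x)
  ... | inj₂ w∈yz with x∈p∪q⁻ ⁅ y ⁆ ⁅ z ⁆ w∈yz
  ...   | inj₁ w∈y = inj₂ (inj₁ (x∈⁅y⁆⇒x≡y y w∈y))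
  ...   | inj₂ w∈z = inj₂ (inj₂ (x∈⁅y⁆⇒x≡y z w∈z))

  triple-swapˡ : triple x y z ≡ triple y x z
  triple-swapˡ = begin
    ⁅ x ⁆ ∪ ⁅ y ⁆ ∪ ⁅ z ⁆   ≡⟨ ∪-assoc ⁅ x ⁆ ⁅ y ⁆ ⁅ z ⁆ ⟨
    (⁅ x ⁆ ∪ ⁅ y ⁆) ∪ ⁅ z ⁆ ≡⟨ cong (_∪ ⁅ z ⁆) (∪-comm ⁅ x ⁆ ⁅ y ⁆) ⟩
    (⁅ y ⁆ ∪ ⁅ x ⁆) ∪ ⁅ z ⁆ ≡⟨ ∪-assoc ⁅ y ⁆ ⁅ x ⁆ ⁅ z ⁆ ⟩
    ⁅ y ⁆ ∪ ⁅ x ⁆ ∪ ⁅ z ⁆   ∎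
    where open ≡-Reasoning

  triple-swapʳ : triple x y z ≡ triple x z y
  triple-swapʳ = cong (⁅ x ⁆ ∪_) (∪-comm ⁅ y ⁆ ⁅ z ⁆)

triple-rotate : ∀ {n} {x y z : Fin n} → triple x y z ≡ triple y z x
triple-rotate = trans triple-swapˡ triple-swapʳ

∈-pair⁺ : ∀ {n} {w x y : Fin n} → w ≡ x ⊎ w ≡ y → w ∈ ⁅ x ⁆ ∪ ⁅ y ⁆
∈-pair⁺ (inj₁ refl) = x∈p∪q⁺ (inj₁ (x∈⁅x⁆ _))
∈-pair⁺ (inj₂ refl) = x∈p∪q⁺ (inj₂ (x∈⁅x⁆ _))

module _ {n : ℕ} {p : Subset n} (∣p∣≡3 : ∣ p ∣ ≡ 3) where

  ∣p∣≡3⇒⊈pair : ∀ {x y} → ¬ p ⊆ ⁅ x ⁆ ∪ ⁅ y ⁆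
  ∣p∣≡3⇒⊈pair {x} {y} p⊆xy = 3≰2 (begin
    3                       ≡⟨ ∣p∣≡3 ⟨
    ∣ p ∣                   ≤⟨ p⊆q⇒∣p∣≤∣q∣ p⊆xy ⟩
    ∣ ⁅ x ⁆ ∪ ⁅ y ⁆ ∣       ≤⟨ ∣p∪q∣≤∣p∣+∣q∣ ⁅ x ⁆ ⁅ y ⁆ ⟩
    ∣ ⁅ x ⁆ ∣ + ∣ ⁅ y ⁆ ∣   ≡⟨ cong₂ _+_ (∣⁅x⁆∣≡1 x) (∣⁅x⁆∣≡1 y) ⟩
    2                       ∎)
    where
    open ≤-Reasoning
    3≰2 : ¬ 3 ≤ 2
    3≰2 (s≤s (s≤s ()))

  ∣p∣≡3⇒∃third : ∀ x y → ∃ λ z → z ∈ p × z ≢ x × z ≢ y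
  ∣p∣≡3⇒∃third x y with any? (λ z → z ∈? p ×-dec ¬? (z ≟ x) ×-dec ¬? (z ≟ y))
  ... | yes found = found
  ... | no none = ⊥-elim (∣p∣≡3⇒⊈pair p⊆xy)
    where
    p⊆xy : p ⊆ ⁅ x ⁆ ∪ ⁅ y ⁆
    p⊆xy {w} w∈p with w ≟ x | w ≟ y
    ... | yes w≡x | _       = ∈-pair⁺ (inj₁ w≡x)
    ... | no _    | yes w≡y = ∈-pair⁺ (inj₂ w≡y)
    ... | no w≢x  | no w≢y  = ⊥-elim (none (w , w∈p , w≢x , w≢y))

  ∣p∣≡3⇒⊆triple : ∀ {x y z} → x ∈ p → y ∈ p → z ∈ p →
    x ≢ y → x ≢ z → y ≢ z → p ⊆ triple x y z
  ∣p∣≡3⇒⊆triple {x} {y} {z} x∈p y∈p z∈p x≢y x≢z y≢z {w} w∈p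
    with w ≟ x | w ≟ y | w ≟ z
  ... | yes refl | _        | _        = x∈triple
  ... | _        | yes refl | _        = y∈triple
  ... | _        | _        | yes refl = z∈triple
  ... | no w≢x   | no w≢y   | no w≢z   =
    ⊥-elim (4≰3 (subst (4 ≤_) ∣p∣≡3 (unique⇒length≤∣p∣ wxyz-unique wxyz⊆p)))
    where
    wxyz-unique : Unique (w ∷ x ∷ y ∷ z ∷ [])
    wxyz-unique = (w≢x ∷ w≢y ∷ w≢z ∷ []) ∷ (x≢y ∷ x≢z ∷ []) ∷ (y≢z ∷ []) ∷ [] ∷ []
    wxyz⊆p : All (_∈ p) (w ∷ x ∷ y ∷ z ∷ [])
    wxyz⊆p = w∈p ∷ x∈p ∷ y∈p ∷ z∈p ∷ []
    4≰3 : ¬ 4 ≤ 3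
    4≰3 (s≤s (s≤s (s≤s ())))

  ∣p∣≡3⇒≡triple : ∀ {x y} → x ∈ p → y ∈ p → x ≢ y → ∃ λ z → p ≡ triple x y z
  ∣p∣≡3⇒≡triple {x} {y} x∈p y∈p x≢y with ∣p∣≡3⇒∃third x y
  ... | z , z∈p , z≢x , z≢y =
    z , ⊆-antisym (∣p∣≡3⇒⊆triple x∈p y∈p z∈p x≢y (≢-sym z≢x) (≢-sym z≢y)) triple⊆p
    where
    triple⊆p : triple x y z ⊆ p
    triple⊆p w∈ with ∈-triple⁻ w∈
    ... | inj₁ refl        = x∈p
    ... | inj₂ (inj₁ refl) = y∈p
    ... | inj₂ (inj₂ refl) = z∈p

∣triple∣≡3⇒distinct : ∀ {n} {x y z : Fin n} → ∣ triple x y z ∣ ≡ 3 → x ≢ y × x ≢ z × y ≢ z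
∣triple∣≡3⇒distinct {x = x} {y} {z} ∣t∣≡3 = x≢y , x≢z , y≢z
  where
  not-within : ∀ {a b} → (∀ {w} → w ≡ x ⊎ w ≡ y ⊎ w ≡ z → w ≡ a ⊎ w ≡ b) → ⊥
  not-within f = ∣p∣≡3⇒⊈pair ∣t∣≡3 (∈-pair⁺ ∘ f ∘ ∈-triple⁻)
  x≢y : x ≢ y
  x≢y x≡y = not-within [ inj₁ ∘ (λ w≡x → trans w≡x x≡y) , id ]
  x≢z : x ≢ z
  x≢z x≡z = not-within [ inj₁ , [ inj₂ , inj₁ ∘ (λ w≡z → trans w≡z (sym x≡z)) ] ]
  y≢z : y ≢ z
  y≢z y≡z = not-within [ inj₁ , [ inj₂ , inj₂ ∘ (λ w≡z → trans w≡z (sym y≡z)) ] ]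

lookup-injective : ∀ {A : Set} {xs : List A} → Unique xs → ∀ i j → lookup xs i ≡ lookup xs j → i ≡ j
lookup-injective {xs = _ ∷ _} _ zero zero _ = refl
lookup-injective {xs = _ ∷ _} (x∉ ∷ _) zero (suc j) x≡ = ⊥-elim (All.lookup x∉ (∈-lookup j) x≡)
lookup-injective {xs = _ ∷ _} (x∉ ∷ _) (suc i) zero ≡x = ⊥-elim (All.lookup x∉ (∈-lookup i) (sym ≡x))
lookup-injective {xs = _ ∷ _} (_ ∷ u) (suc i) (suc j) eq = cong suc (lookup-injective u i j eq)

enumeration⇒permutation : ∀ {n} {xs : List (Fin n)} → Unique xs → (∀ y → y ∈ₗ xs) →
  Permutation (length xs) n
enumeration⇒permutation {xs = xs} u complete = permutation (lookup xs) (λ y → index (complete y))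
  (λ y → sym (lookup-index (complete y)))
  (λ i → lookup-injective u _ _ (sym (lookup-index (complete (lookup xs i)))))

module _ {v : ℕ} (𝓑 : List (Subset v)) where

  Good : List (Fin v) → Set
  Good (a ∷ b ∷ c ∷ r) = ¬ triple a b c ∈ₗ 𝓑 × Good (b ∷ c ∷ r)
  Good _               = ⊤

  good⇒lookup-good : ∀ {xs} → Good xs → (i j k : Fin (length xs)) →
    toℕ j ≡ suc (toℕ i) → toℕ k ≡ suc (toℕ j) →
    ¬ triple (lookup xs i) (lookup xs j) (lookup xs k) ∈ₗ 𝓑
  good⇒lookup-good {a ∷ b ∷ c ∷ r} (abc , _) zero (suc zero) (suc (suc zero)) refl refl = abc
  good⇒lookup-good {a ∷ b ∷ c ∷ r} (_ , good) (suc i) (suc j) (suc k) ij jk =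
    good⇒lookup-good good i j k (suc-injective ij) (suc-injective jk)
  good⇒lookup-good {_ ∷ _ ∷ []} _ (suc zero) (suc zero) _ () _

module _ {v : ℕ} {𝓑 : List (Subset v)} where

  good-enumeration⇒3-good : ∀ {xs} → Unique xs → (∀ y → y ∈ₗ xs) → Good 𝓑 xs →
    Σ (Sequencing v) λ π → Is3Good 𝓑 (Inverse.to π)
  good-enumeration⇒3-good {xs} u complete good = π , π-good
    where
    perm : Permutation (length xs) v
    perm = enumeration⇒permutation u complete
    v≡len : v ≡ length xs
    v≡len = sym (↔⇒≡ perm)
    π : Sequencing v
    π = cast-id v≡len ∘ₚ perm
    cast-consecutive : ∀ {i j} → toℕ j ≡ suc (toℕ i) → toℕ (cast v≡len j) ≡ suc (toℕ (cast v≡len i))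
    cast-consecutive {i} {j} ij = begin
      toℕ (cast v≡len j)       ≡⟨ toℕ-cast v≡len j ⟩
      toℕ j                    ≡⟨ ij ⟩
      suc (toℕ i)              ≡⟨ cong suc (toℕ-cast v≡len i) ⟨
      suc (toℕ (cast v≡len i)) ∎
      where open ≡-Reasoning
    π-good : Is3Good 𝓑 (Inverse.to π)
    π-good i j k ij jk = good⇒lookup-good 𝓑 good (cast v≡len i) (cast v≡len j) (cast v≡len k)
      (cast-consecutive ij) (cast-consecutive jk)

module STS {v : ℕ} {𝓑 : List (Subset v)} (sts : IsSTS v 𝓑) where
  open IsSTS sts

  block-distinct : ∀ {x y z} → triple x y z ∈ₗ 𝓑 → x ≢ y × x ≢ z × y ≢ z
  block-distinct = ∣triple∣≡3⇒distinct ∘ triples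

  completion : ∀ {x y} → x ≢ y → ∃ λ z → triple x y z ∈ₗ 𝓑
  completion {x} {y} x≢y with covered x y x≢y
  ... | B , B∈𝓑 , x∈B , y∈B with ∣p∣≡3⇒≡triple (triples B∈𝓑) x∈B y∈B x≢y
  ...   | z , B≡xyz = z , subst (_∈ₗ 𝓑) B≡xyz B∈𝓑

  completion-unique : ∀ {x y z z′} → triple x y z ∈ₗ 𝓑 → triple x y z′ ∈ₗ 𝓑 → z ≡ z′
  completion-unique {x} {y} {z} {z′} xyz∈𝓑 xyz′∈𝓑 =
    [ ⊥-elim ∘ x≢z′ ∘ sym , [ ⊥-elim ∘ y≢z′ ∘ sym , sym ] ] (∈-triple⁻ z′∈xyz)
    where
    x≢y : x ≢ y
    x≢y = proj₁ (block-distinct xyz′∈𝓑)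
    x≢z′ : x ≢ z′
    x≢z′ = proj₁ (proj₂ (block-distinct xyz′∈𝓑))
    y≢z′ : y ≢ z′
    y≢z′ = proj₂ (proj₂ (block-distinct xyz′∈𝓑))
    z′∈xyz : z′ ∈ triple x y z
    z′∈xyz = subst (z′ ∈_) (unique x y x≢y xyz′∈𝓑 x∈triple y∈triple xyz∈𝓑 x∈triple y∈triple)
                   z∈triple

  module Partner (∞ : Fin v) where

    partner : Fin v → Fin v
    partner a with a ≟ ∞
    ... | yes _  = ∞
    ... | no a≢∞ = proj₁ (completion (≢-sym a≢∞))

    partner-block : ∀ {a} → a ≢ ∞ → triple ∞ a (partner a) ∈ₗ 𝓑
    partner-block {a} a≢∞ with a ≟ ∞
    ... | yes a≡∞ = ⊥-elim (a≢∞ a≡∞)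
    ... | no a≢∞′ = proj₂ (completion (≢-sym a≢∞′))

    partner-≢∞ : ∀ {a} → a ≢ ∞ → partner a ≢ ∞
    partner-≢∞ a≢∞ = ≢-sym (proj₁ (proj₂ (block-distinct (partner-block a≢∞))))

    partner-≢ : ∀ {a} → a ≢ ∞ → partner a ≢ a
    partner-≢ a≢∞ = ≢-sym (proj₂ (proj₂ (block-distinct (partner-block a≢∞))))

    partner-involutive : ∀ {a} → a ≢ ∞ → partner (partner a) ≡ a
    partner-involutive a≢∞ =
      completion-unique (partner-block (partner-≢∞ a≢∞))
                        (subst (_∈ₗ 𝓑) triple-swapʳ (partner-block a≢∞))

    partner-injective : ∀ {a b} → a ≢ ∞ → b ≢ ∞ → partner a ≡ partner b → a ≡ b
    partner-injective {a} {b} a≢∞ b≢∞ pa≡pb = begin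
      a                   ≡⟨ partner-involutive a≢∞ ⟨
      partner (partner a) ≡⟨ cong partner pa≡pb ⟩
      partner (partner b) ≡⟨ partner-involutive b≢∞ ⟩
      b                   ∎
      where open ≡-Reasoning

    ¬pair-block : ∀ {a c} → a ≢ ∞ → c ≢ ∞ → ¬ triple a (partner a) c ∈ₗ 𝓑
    ¬pair-block a≢∞ c≢∞ block =
      c≢∞ (completion-unique block (subst (_∈ₗ 𝓑) triple-rotate (partner-block a≢∞)))

    ¬block-pair : ∀ {a c} → a ≢ ∞ → c ≢ ∞ → ¬ triple c a (partner a) ∈ₗ 𝓑
    ¬block-pair a≢∞ c≢∞ = ¬pair-block a≢∞ c≢∞ ∘ subst (_∈ₗ 𝓑) triple-rotate

    ¬block-partner-∞ : ∀ {o u} → o ≢ ∞ → u ≢ o → ¬ triple u (partner o) ∞ ∈ₗ 𝓑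
    ¬block-partner-∞ o≢∞ u≢o block =
      u≢o (completion-unique (subst (_∈ₗ 𝓑) triple-rotate block)
                             (subst (_∈ₗ 𝓑) (trans triple-rotate triple-rotate) (partner-block o≢∞)))

    pairUp : List (Fin v) → List (Fin v)
    pairUp []       = []
    pairUp (a ∷ as) = a ∷ partner a ∷ pairUp as

    Paired : Fin v → Fin v → Set
    Paired a y = y ≡ a ⊎ y ≡ partner a

    ∈-pairUp⁻ : ∀ {y} as → y ∈ₗ pairUp as → ∃ λ a → a ∈ₗ as × Paired a y
    ∈-pairUp⁻ (a ∷ as) (here y≡a)                = a , here refl , inj₁ y≡a
    ∈-pairUp⁻ (a ∷ as) (there (here y≡pa))       = a , here refl , inj₂ y≡pa
    ∈-pairUp⁻ (a ∷ as) (there (there y∈))        with ∈-pairUp⁻ as y∈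
    ... | b , b∈as , paired = b , there b∈as , paired

    ∈-pairUp⁺ : ∀ {a y} as → a ∈ₗ as → Paired a y → y ∈ₗ pairUp as
    ∈-pairUp⁺ (b ∷ as) (here refl) (inj₁ refl) = here refl
    ∈-pairUp⁺ (b ∷ as) (here refl) (inj₂ refl) = there (here refl)
    ∈-pairUp⁺ (b ∷ as) (there a∈as) paired     = there (there (∈-pairUp⁺ as a∈as paired))

    module Sequence (o : Fin v) (o≢∞ : o ≢ ∞) where

      Inner : Fin v → Set
      Inner a = a ≢ ∞ × a ≢ o × a ≢ partner o

      inner? : Decidable Inner
      inner? a = ¬? (a ≟ ∞) ×-dec ¬? (a ≟ o) ×-dec ¬? (a ≟ partner o)

      inner-partner : ∀ {a} → Inner a → Inner (partner a)
      inner-partner {a} (a≢∞ , a≢o , a≢po) =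
        partner-≢∞ a≢∞ ,
        (λ pa≡o → a≢po (trans (sym (partner-involutive a≢∞)) (cong partner pa≡o))) ,
        (λ pa≡po → a≢o (partner-injective a≢∞ o≢∞ pa≡po))

      inner-paired : ∀ {a y} → Inner a → Paired a y → Inner y
      inner-paired inner-a (inj₁ refl) = inner-a
      inner-paired inner-a (inj₂ refl) = inner-partner inner-a

      -- The smaller point of each inner pair, so that pairUp lists every pair once.
      Leader : Fin v → Set
      Leader a = Inner a × toℕ a < toℕ (partner a)

      leader? : Decidable Leader
      leader? a = inner? a ×-dec (toℕ a <ℕ? toℕ (partner a))

      leaders : List (Fin v)
      leaders = filter leader? (allFin v)

      leader∈leaders : ∀ {a} → Leader a → a ∈ₗ leaders
      leader∈leaders {a} = ∈-filter⁺ leader? (∈-allFin a)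

      ∃-paired-leader : ∀ {y} → Inner y → ∃ λ a → Leader a × Paired a y
      ∃-paired-leader {y} inner-y@(y≢∞ , _) with <-cmp (toℕ y) (toℕ (partner y))
      ... | tri< y<py _ _ = y , (inner-y , y<py) , inj₁ refl
      ... | tri≈ _ y≡py _ = ⊥-elim (partner-≢ y≢∞ (sym (toℕ-injective y≡py)))
      ... | tri> _ _ py<y =
        partner y , (inner-partner inner-y , subst (λ a → toℕ (partner y) < toℕ a) ppy≡y py<y) , inj₂ ppy≡y
        where
        ppy≡y : y ≡ partner (partner y)
        ppy≡y = sym (partner-involutive y≢∞)

      inner⇒∈pairUp-leaders : ∀ {y} → Inner y → y ∈ₗ pairUp leaders
      inner⇒∈pairUp-leaders inner-y with ∃-paired-leader inner-y
      ... | a , leader-a , paired = ∈-pairUp⁺ leaders (leader∈leaders leader-a) paired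

      leader-≢-partner : ∀ {a b} → Leader a → Leader b → a ≢ partner b
      leader-≢-partner {a} {b} (_ , a<pa) ((b≢∞ , _) , b<pb) a≡pb = <-asym a<b b<a
        where
        a<b : toℕ a < toℕ b
        a<b = subst (λ t → toℕ a < toℕ t) (trans (cong partner a≡pb) (partner-involutive b≢∞)) a<pa
        b<a : toℕ b < toℕ a
        b<a = subst (λ t → toℕ b < toℕ t) (sym a≡pb) b<pb

      paired-leaders-≡ : ∀ {a b y} → Leader a → Leader b → Paired a y → Paired b y → a ≡ b
      paired-leaders-≡ _  _  (inj₁ y≡a)  (inj₁ y≡b)  = trans (sym y≡a) y≡b
      paired-leaders-≡ la lb (inj₁ y≡a)  (inj₂ y≡pb) =
        ⊥-elim (leader-≢-partner la lb (trans (sym y≡a) y≡pb))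
      paired-leaders-≡ la lb (inj₂ y≡pa) (inj₁ y≡b)  =
        ⊥-elim (leader-≢-partner lb la (trans (sym y≡b) y≡pa))
      paired-leaders-≡ ((a≢∞ , _) , _) ((b≢∞ , _) , _) (inj₂ y≡pa) (inj₂ y≡pb) =
        partner-injective a≢∞ b≢∞ (trans (sym y≡pa) y≡pb)

      paired-with-leader-∉ : ∀ {a y} as → Leader a → All (a ≢_) as → All Leader as →
        Paired a y → y ∉ₗ pairUp as
      paired-with-leader-∉ as la a∉as las paired-a y∈ with ∈-pairUp⁻ as y∈
      ... | b , b∈as , paired-b =
        All.lookup a∉as b∈as (paired-leaders-≡ la (All.lookup las b∈as) paired-a paired-b)

      pairUp-unique : ∀ {as} → Unique as → All Leader as → Unique (pairUp as)
      pairUp-unique {[]}     []         []         = []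
      pairUp-unique {a ∷ as} (a∉as ∷ u) (la ∷ las) =
        (≢-sym (partner-≢ (proj₁ (proj₁ la))) ∷ distinct-from (inj₁ refl))
        ∷ distinct-from (inj₂ refl) ∷ pairUp-unique u las
        where
        distinct-from : ∀ {y} → Paired a y → All (y ≢_) (pairUp as)
        distinct-from paired = All.tabulate λ z∈ y≡z →
          paired-with-leader-∉ as la a∉as las paired (subst (_∈ₗ pairUp as) (sym y≡z) z∈)

      leaders-leader : All Leader leaders
      leaders-leader = all-filter leader? (allFin v)

      ∈-pairUp-leaders⇒inner : ∀ {y} → y ∈ₗ pairUp leaders → Inner y
      ∈-pairUp-leaders⇒inner y∈ with ∈-pairUp⁻ leaders y∈
      ... | a , a∈ , paired = inner-paired (proj₁ (All.lookup leaders-leader a∈)) paired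

      closing : List (Fin v)
      closing = partner o ∷ ∞ ∷ []

      sequence : List (Fin v)
      sequence = o ∷ pairUp leaders ++ closing

      sequence-unique : Unique sequence
      sequence-unique =
        All.tabulate o≢ ∷ Unique.++⁺ pairs-unique ((partner-≢∞ o≢∞ ∷ []) ∷ [] ∷ []) disjoint
        where
        pairs-unique : Unique (pairUp leaders)
        pairs-unique = pairUp-unique (Unique.filter⁺ leader? (Unique.allFin⁺ v)) leaders-leader
        o≢ : ∀ {y} → y ∈ₗ pairUp leaders ++ closing → o ≢ y
        o≢ y∈ with ∈-++⁻ (pairUp leaders) y∈
        ... | inj₁ y∈pairs             = ≢-sym (proj₁ (proj₂ (∈-pairUp-leaders⇒inner y∈pairs)))
        ... | inj₂ (here refl)         = ≢-sym (partner-≢ o≢∞)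
        ... | inj₂ (there (here refl)) = o≢∞
        disjoint : ∀ {y} → ¬ (y ∈ₗ pairUp leaders × y ∈ₗ closing)
        disjoint (y∈ , here refl)         = proj₂ (proj₂ (∈-pairUp-leaders⇒inner y∈)) refl
        disjoint (y∈ , there (here refl)) = proj₁ (∈-pairUp-leaders⇒inner y∈) refl

      sequence-complete : ∀ y → y ∈ₗ sequence
      sequence-complete y with y ≟ o | y ≟ partner o | y ≟ ∞
      ... | yes refl | _        | _        = here refl
      ... | no _     | yes refl | _        = there (∈-++⁺ʳ (pairUp leaders) (here refl))
      ... | no _     | no _     | yes refl = there (∈-++⁺ʳ (pairUp leaders) (there (here refl)))
      ... | no y≢o   | no y≢po  | no y≢∞   = there (∈-++⁺ˡ (inner⇒∈pairUp-leaders (y≢∞ , y≢o , y≢po)))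

      pairUp-closing-good : ∀ {c} as → Inner c → All Inner as →
        Good 𝓑 (c ∷ partner c ∷ pairUp as ++ closing)
      pairUp-closing-good [] inner-c@(c≢∞ , _) [] =
        ¬pair-block c≢∞ (partner-≢∞ o≢∞) ,
        ¬block-partner-∞ o≢∞ (proj₁ (proj₂ (inner-partner inner-c))) , _
      pairUp-closing-good (a ∷ as) (c≢∞ , _) (inner-a ∷ inner-as) =
        ¬pair-block c≢∞ (proj₁ inner-a) ,
        ¬block-pair (proj₁ inner-a) (partner-≢∞ c≢∞) ,
        pairUp-closing-good as inner-a inner-as

      sequence-good : ∃ Inner → Good 𝓑 sequence
      sequence-good (_ , inner-w) with ∃-paired-leader inner-w
      ... | a , leader-a , _ =
        opening-good leaders (leader∈leaders leader-a) (All.map proj₁ leaders-leader)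
        where
        opening-good : ∀ {a} as → a ∈ₗ as → All Inner as → Good 𝓑 (o ∷ pairUp as ++ closing)
        opening-good (b ∷ bs) _ (inner-b ∷ inner-bs) =
          ¬block-pair (proj₁ inner-b) o≢∞ , pairUp-closing-good bs inner-b inner-bs

fourth-point : ∀ {k} (x : Fin (4 + k)) → ∃ λ w → w ≢ zero × w ≢ suc zero × w ≢ x
fourth-point x with x ≟ suc (suc zero)
... | yes refl = suc (suc (suc zero)) , (λ ()) , (λ ()) , (λ ())
... | no x≢2   = suc (suc zero) , (λ ()) , (λ ()) , ≢-sym x≢2

theorem2 : (v : ℕ) → 3 < v → (𝓑 : List (Subset v)) → IsSTS v 𝓑 →
    Σ (Sequencing v) λ π → Is3Good 𝓑 (Inverse.to π)
theorem2 (suc (suc (suc (suc k)))) _ 𝓑 sts =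
  good-enumeration⇒3-good sequence-unique sequence-complete
    (sequence-good (fourth-point (partner (suc zero))))
  where
  open STS sts
  open Partner zero
  open Sequence (suc zero) (λ ())
theorem2 1 (s≤s ())
theorem2 2 (s≤s (s≤s ()))
theorem2 3 (s≤s (s≤s (s≤s ())))
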